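{- For every integer $n\ge 5$, \begin{align*} (n-1)(n-2)T_{n-1} &=6 \sum_{\substack{k_1+k_2+k_3=n-5\\ k_1,k_2,k_3\ge 0}}T_{k_1}T_{k_2}T_{k_3} +6 \sum_{\substack{k_1+k_2+k_3=n-4\\ k_1,k_2,k_3\ge 0}}T_{k_1}T_{k_2}T_{k_3} +12 \sum_{\substack{k_1+k_2+k_3=n-2\\ k_1,k_2,k_3\ge 0}}T_{k_1}T_{k_2}T_{k_3}\\ &\quad+6 \sum_{\substack{k_1+k_2+k_3=n-1\\ k_1,k_2,k_3\ge 0}}T_{k_1}T_{k_2}T_{k_3} +2 \sum_{\substack{k_1+k_2+k_3=n\\ k_1,k_2,k_3\ge 0}}T_{k_1}T_{k_2}T_{k_3}. \end{align*}
   Context: The Tribonacci numbers $T_n$ are defined by $T_0=0$, $T_1=T_2=1$ and $T_n=T_{n-1}+T_{n-2}+T_{n-3}$ for $n\ge 3$. -}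

module Defs where

open import Data.Nat using (ℕ; zero; suc; _+_; _*_; _∸_)

T : ℕ → ℕ
T zero = 0
T (suc zero) = 1
T (suc (suc zero)) = 1
T (suc (suc (suc n))) = T (suc (suc n)) + T (suc n) + T n

sumTo : ℕ → (ℕ → ℕ) → ℕ
sumTo zero f = f 0
sumTo (suc N) f = sumTo N f + f (suc N)

-- S N = Σ_{k1+k2+k3 = N, ki ≥ 0} T k1 * T k2 * T k3
-- (k1 ranges over 0..N, k2 over 0..N-k1, and k3 = N - k1 - k2)
S : ℕ → ℕ
S N = sumTo N (λ k₁ → sumTo (N ∸ k₁) (λ k₂ → T k₁ * T k₂ * T (N ∸ k₁ ∸ k₂)))

{-# OPTIONS --safe #-}
-- With t(x) = Σ Tₙ xⁿ and p = 1 + x + x², the recurrence says t = x (1 + p t).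
-- Applying θ = x d/dx gives θt = t + (1 + 2x + 3x²) t², and the Leibniz rule gives
-- θ(t²) = 2 t · θt = 2 t² + 2 (1 + 2x + 3x²) t³.  Reading the first identity at degree k
-- and the second at degrees k, k − 1, k − 2 expresses k (k − 1) Tₖ through the
-- coefficients of t² and t³; those of t² are then eliminated with t³ = x (t² + p t³).
module Submission where

open import Defs
open import Data.List.Base using (_∷_; [])
open import Data.Nat using (ℕ; zero; suc; _+_; _*_; _∸_; _≤_; z≤n; s≤s)
open import Data.Nat.Properties
open import Data.Nat.Tactic.RingSolver using (solve-∀; solve)
open import Relation.Binary.PropositionalEquality
open ≡-Reasoning

sumTo-cong : ∀ N {f g : ℕ → ℕ} → (∀ k → k ≤ N → f k ≡ g k) → sumTo N f ≡ sumTo N g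
sumTo-cong zero    f≡g = f≡g 0 z≤n
sumTo-cong (suc N) f≡g =
  cong₂ _+_ (sumTo-cong N (λ k k≤N → f≡g k (m≤n⇒m≤1+n k≤N))) (f≡g (suc N) ≤-refl)

sumTo-suc : ∀ N (f : ℕ → ℕ) → sumTo (suc N) f ≡ f 0 + sumTo N (λ k → f (suc k))
sumTo-suc zero    f = refl
sumTo-suc (suc N) f = begin
  sumTo (suc N) f + f (suc (suc N))
    ≡⟨ cong (_+ f (suc (suc N))) (sumTo-suc N f) ⟩
  f 0 + sumTo N (λ k → f (suc k)) + f (suc (suc N))
    ≡⟨ +-assoc (f 0) _ _ ⟩
  f 0 + sumTo (suc N) (λ k → f (suc k)) ∎

sumTo-+ : ∀ N (f g : ℕ → ℕ) → sumTo N (λ k → f k + g k) ≡ sumTo N f + sumTo N g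
sumTo-+ zero    f g = refl
sumTo-+ (suc N) f g = begin
  sumTo N (λ k → f k + g k) + (f (suc N) + g (suc N))
    ≡⟨ cong (_+ (f (suc N) + g (suc N))) (sumTo-+ N f g) ⟩
  sumTo N f + sumTo N g + (f (suc N) + g (suc N))
    ≡⟨ +-interchange (sumTo N f) _ _ _ ⟩
  sumTo N f + f (suc N) + (sumTo N g + g (suc N)) ∎
  where
  +-interchange : ∀ a b c d → a + b + (c + d) ≡ a + c + (b + d)
  +-interchange = solve-∀

*-distribˡ-sumTo : ∀ N c (f : ℕ → ℕ) → c * sumTo N f ≡ sumTo N (λ k → c * f k)
*-distribˡ-sumTo zero    c f = refl
*-distribˡ-sumTo (suc N) c f =
  trans (*-distribˡ-+ c (sumTo N f) (f (suc N)))
        (cong (_+ c * f (suc N)) (*-distribˡ-sumTo N c f))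

sumTo-zero : ∀ N → sumTo N (λ _ → 0) ≡ 0
sumTo-zero zero    = refl
sumTo-zero (suc N) = cong (_+ 0) (sumTo-zero N)

sumTo-reverse : ∀ N (f : ℕ → ℕ) → sumTo N f ≡ sumTo N (λ k → f (N ∸ k))
sumTo-reverse zero    f = refl
sumTo-reverse (suc N) f = begin
  sumTo N f + f (suc N)                  ≡⟨ cong (_+ f (suc N)) (sumTo-reverse N f) ⟩
  sumTo N (λ k → f (N ∸ k)) + f (suc N)  ≡⟨ +-comm _ (f (suc N)) ⟩
  f (suc N) + sumTo N (λ k → f (N ∸ k))  ≡⟨ sumTo-suc N (λ k → f (suc N ∸ k)) ⟨
  sumTo (suc N) (λ k → f (suc N ∸ k))    ∎

Seq : Set
Seq = ℕ → ℕ

infixl 6 _⊕_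
infixr 8 _·_
infixl 7 _⋆_

δ : Seq
δ zero    = 1
δ (suc _) = 0

shift : Seq → Seq
shift a zero    = 0
shift a (suc n) = a n

_⊕_ : Seq → Seq → Seq
(a ⊕ b) n = a n + b n

_·_ : ℕ → Seq → Seq
(c · a) n = c * a n

_⋆_ : Seq → Seq → Seq
(a ⋆ b) n = sumTo n (λ k → a k * b (n ∸ k))

θ : Seq → Seq
θ a n = n * a n

poly : ℕ → ℕ → ℕ → Seq → Seq
poly c₀ c₁ c₂ a = c₀ · a ⊕ c₁ · shift a ⊕ c₂ · shift (shift a)

shift-cong : ∀ {a b} → a ≗ b → shift a ≗ shift b
shift-cong a≗b zero    = refl
shift-cong a≗b (suc n) = a≗b n

poly-cong : ∀ c₀ c₁ c₂ {a b} → a ≗ b → poly c₀ c₁ c₂ a ≗ poly c₀ c₁ c₂ b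
poly-cong c₀ c₁ c₂ a≗b n = cong₂ _+_
  (cong₂ _+_ (cong (c₀ *_) (a≗b n)) (cong (c₁ *_) (shift-cong a≗b n)))
  (cong (c₂ *_) (shift-cong (shift-cong a≗b) n))

⋆-congˡ : ∀ {a a′} b → a ≗ a′ → a ⋆ b ≗ a′ ⋆ b
⋆-congˡ b a≗a′ n = sumTo-cong n (λ k _ → cong (_* b (n ∸ k)) (a≗a′ k))

⋆-congʳ : ∀ a {b b′} → b ≗ b′ → a ⋆ b ≗ a ⋆ b′
⋆-congʳ a b≗b′ n = sumTo-cong n (λ k _ → cong (a k *_) (b≗b′ (n ∸ k)))

⋆-comm : ∀ a b → a ⋆ b ≗ b ⋆ a
⋆-comm a b n = trans (sumTo-reverse n _) (sumTo-cong n λ k k≤n → begin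
  a (n ∸ k) * b (n ∸ (n ∸ k)) ≡⟨ cong (λ j → a (n ∸ k) * b j) (m∸[m∸n]≡n k≤n) ⟩
  a (n ∸ k) * b k             ≡⟨ *-comm (a (n ∸ k)) (b k) ⟩
  b k * a (n ∸ k)             ∎)

⋆-distribʳ-⊕ : ∀ a a′ b → (a ⊕ a′) ⋆ b ≗ a ⋆ b ⊕ a′ ⋆ b
⋆-distribʳ-⊕ a a′ b n =
  trans (sumTo-cong n (λ k _ → *-distribʳ-+ (b (n ∸ k)) (a k) (a′ k))) (sumTo-+ n _ _)

⋆-distribˡ-⊕ : ∀ a b b′ → a ⋆ (b ⊕ b′) ≗ a ⋆ b ⊕ a ⋆ b′
⋆-distribˡ-⊕ a b b′ n = begin
  (a ⋆ (b ⊕ b′)) n       ≡⟨ ⋆-comm a (b ⊕ b′) n ⟩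
  ((b ⊕ b′) ⋆ a) n       ≡⟨ ⋆-distribʳ-⊕ b b′ a n ⟩
  (b ⋆ a ⊕ b′ ⋆ a) n     ≡⟨ cong₂ _+_ (⋆-comm b a n) (⋆-comm b′ a n) ⟩
  (a ⋆ b ⊕ a ⋆ b′) n     ∎

·-⋆ : ∀ c a b → (c · a) ⋆ b ≗ c · (a ⋆ b)
·-⋆ c a b n =
  trans (sumTo-cong n (λ k _ → *-assoc c (a k) (b (n ∸ k)))) (sym (*-distribˡ-sumTo n c _))

shift-⋆ : ∀ a b → shift a ⋆ b ≗ shift (a ⋆ b)
shift-⋆ a b zero    = refl
shift-⋆ a b (suc n) = sumTo-suc n _

⋆-identityˡ : ∀ b → δ ⋆ b ≗ b
⋆-identityˡ b zero    = +-identityʳ (b 0)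
⋆-identityˡ b (suc n) = begin
  (δ ⋆ b) (suc n)                     ≡⟨ sumTo-suc n _ ⟩
  b (suc n) + 0 + sumTo n (λ _ → 0)   ≡⟨ cong₂ _+_ (+-identityʳ (b (suc n))) (sumTo-zero n) ⟩
  b (suc n) + 0                       ≡⟨ +-identityʳ (b (suc n)) ⟩
  b (suc n)                           ∎

poly-⋆ : ∀ c₀ c₁ c₂ a b → poly c₀ c₁ c₂ a ⋆ b ≗ poly c₀ c₁ c₂ (a ⋆ b)
poly-⋆ c₀ c₁ c₂ a b n = begin
  (poly c₀ c₁ c₂ a ⋆ b) n
    ≡⟨ ⋆-distribʳ-⊕ (c₀ · a ⊕ c₁ · shift a) (c₂ · shift (shift a)) b n ⟩
  ((c₀ · a ⊕ c₁ · shift a) ⋆ b) n + (c₂ · shift (shift a) ⋆ b) n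
    ≡⟨ cong₂ _+_ (⋆-distribʳ-⊕ (c₀ · a) (c₁ · shift a) b n) (·-⋆ c₂ (shift (shift a)) b n) ⟩
  (c₀ · a ⋆ b) n + (c₁ · shift a ⋆ b) n + c₂ * (shift (shift a) ⋆ b) n
    ≡⟨ cong₂ _+_ (cong₂ _+_ (·-⋆ c₀ a b n) (·-⋆ c₁ (shift a) b n)) refl ⟩
  c₀ * (a ⋆ b) n + c₁ * (shift a ⋆ b) n + c₂ * (shift (shift a) ⋆ b) n
    ≡⟨ cong₂ _+_ (cong (λ z → c₀ * (a ⋆ b) n + c₁ * z) (shift-⋆ a b n))
                 (cong (c₂ *_) (trans (shift-⋆ (shift a) b n)
                                      (shift-cong (shift-⋆ a b) n))) ⟩
  poly c₀ c₁ c₂ (a ⋆ b) n ∎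

⋆-poly : ∀ c₀ c₁ c₂ a b → a ⋆ poly c₀ c₁ c₂ b ≗ poly c₀ c₁ c₂ (a ⋆ b)
⋆-poly c₀ c₁ c₂ a b n =
  trans (⋆-comm a (poly c₀ c₁ c₂ b) n) (trans (poly-⋆ c₀ c₁ c₂ b a n) (poly-cong c₀ c₁ c₂ (⋆-comm b a) n))

shift[δ⊕a]⋆b : ∀ a b → shift (δ ⊕ a) ⋆ b ≗ shift (b ⊕ a ⋆ b)
shift[δ⊕a]⋆b a b n = trans (shift-⋆ (δ ⊕ a) b n) (shift-cong (λ m →
  trans (⋆-distribʳ-⊕ δ a b m) (cong (_+ (a ⋆ b) m) (⋆-identityˡ b m))) n)

θ-⋆ : ∀ a b → θ (a ⋆ b) ≗ θ a ⋆ b ⊕ a ⋆ θ b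
θ-⋆ a b n = trans (*-distribˡ-sumTo n n _) (trans (sumTo-cong n split) (sumTo-+ n _ _))
  where
  distribute : ∀ k d x y → (k + d) * (x * y) ≡ k * x * y + x * (d * y)
  distribute = solve-∀
  split : ∀ k → k ≤ n → n * (a k * b (n ∸ k)) ≡ k * a k * b (n ∸ k) + a k * ((n ∸ k) * b (n ∸ k))
  split k k≤n = trans (cong (_* (a k * b (n ∸ k))) (sym (m+[n∸m]≡n k≤n)))
                      (distribute k (n ∸ k) (a k) (b (n ∸ k)))

T-recurrence : T ≗ shift (δ ⊕ poly 1 1 1 T)
T-recurrence zero                = refl
T-recurrence (suc zero)          = refl
T-recurrence (suc (suc zero))    = refl
T-recurrence (suc (suc (suc n))) = shape (T (suc (suc n))) (T (suc n)) (T n)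
  where
  shape : ∀ x y z → x + y + z ≡ 0 + (1 * x + 1 * y + 1 * z)
  shape = solve-∀

θT-recurrence : θ T ≗ shift (δ ⊕ (poly 1 2 3 T ⊕ poly 1 1 1 (θ T)))
θT-recurrence zero                = refl
θT-recurrence (suc zero)          = refl
θT-recurrence (suc (suc zero))    = refl
θT-recurrence (suc (suc (suc n))) = shape n (T (suc (suc n))) (T (suc n)) (T n)
  where
  shape : ∀ n x y z → (3 + n) * (x + y + z)
        ≡ 0 + ((1 * x + 2 * y + 3 * z)
               + (1 * ((2 + n) * x) + 1 * ((1 + n) * y) + 1 * (n * z)))
  shape = solve-∀

T⋆-recurrence : ∀ b → T ⋆ b ≗ shift (b ⊕ poly 1 1 1 (T ⋆ b))
T⋆-recurrence b n = begin
  (T ⋆ b) n                                  ≡⟨ ⋆-congˡ b T-recurrence n ⟩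
  (shift (δ ⊕ poly 1 1 1 T) ⋆ b) n           ≡⟨ shift[δ⊕a]⋆b (poly 1 1 1 T) b n ⟩
  shift (b ⊕ poly 1 1 1 T ⋆ b) n
    ≡⟨ shift-cong (λ m → cong (b m +_) (poly-⋆ 1 1 1 T b m)) n ⟩
  shift (b ⊕ poly 1 1 1 (T ⋆ b)) n           ∎

-- t · θt computed from either factor's recurrence; the common term x p (t · θt) cancels.
θT-euler : θ T ≗ T ⊕ poly 1 2 3 (T ⋆ T)
θT-euler n = +-cancelʳ-≡ (poly 1 1 1 W n) _ _ (begin
  θ T n + poly 1 1 1 W n                        ≡⟨ T⋆-recurrence (θ T) (suc n) ⟨
  W (suc n)                                     ≡⟨ ⋆-comm T (θ T) (suc n) ⟩
  (θ T ⋆ T) (suc n)                             ≡⟨ θT⋆T (suc n) ⟩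
  T n + poly 1 2 3 (T ⋆ T) n + poly 1 1 1 W n   ∎)
  where
  W = T ⋆ θ T
  θT⋆T : θ T ⋆ T ≗ shift (T ⊕ poly 1 2 3 (T ⋆ T) ⊕ poly 1 1 1 W)
  θT⋆T m = begin
    (θ T ⋆ T) m
      ≡⟨ ⋆-congˡ T θT-recurrence m ⟩
    (shift (δ ⊕ (poly 1 2 3 T ⊕ poly 1 1 1 (θ T))) ⋆ T) m
      ≡⟨ shift[δ⊕a]⋆b _ T m ⟩
    shift (T ⊕ (poly 1 2 3 T ⊕ poly 1 1 1 (θ T)) ⋆ T) m
      ≡⟨ shift-cong (λ i → begin
           T i + ((poly 1 2 3 T ⊕ poly 1 1 1 (θ T)) ⋆ T) i
             ≡⟨ cong (T i +_) (⋆-distribʳ-⊕ (poly 1 2 3 T) _ T i) ⟩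
           T i + ((poly 1 2 3 T ⋆ T) i + (poly 1 1 1 (θ T) ⋆ T) i)
             ≡⟨ cong (T i +_) (cong₂ _+_ (poly-⋆ 1 2 3 T T i)
                  (trans (poly-⋆ 1 1 1 (θ T) T i) (poly-cong 1 1 1 (⋆-comm (θ T) T) i))) ⟩
           T i + (poly 1 2 3 (T ⋆ T) i + poly 1 1 1 W i)
             ≡⟨ +-assoc (T i) _ _ ⟨
           T i + poly 1 2 3 (T ⋆ T) i + poly 1 1 1 W i ∎) m ⟩
    shift (T ⊕ poly 1 2 3 (T ⋆ T) ⊕ poly 1 1 1 W) m ∎

θ[T⋆T] : θ (T ⋆ T) ≗ 2 · (T ⋆ θ T)
θ[T⋆T] n = begin
  θ (T ⋆ T) n                              ≡⟨ θ-⋆ T T n ⟩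
  (θ T ⋆ T) n + (T ⋆ θ T) n                ≡⟨ cong (_+ (T ⋆ θ T) n) (⋆-comm (θ T) T n) ⟩
  (T ⋆ θ T) n + (T ⋆ θ T) n                ≡⟨ cong ((T ⋆ θ T) n +_) (+-identityʳ _) ⟨
  2 * (T ⋆ θ T) n                          ∎

T⋆θT : T ⋆ θ T ≗ T ⋆ T ⊕ poly 1 2 3 (T ⋆ (T ⋆ T))
T⋆θT n = begin
  (T ⋆ θ T) n                                 ≡⟨ ⋆-congʳ T θT-euler n ⟩
  (T ⋆ (T ⊕ poly 1 2 3 (T ⋆ T))) n            ≡⟨ ⋆-distribˡ-⊕ T T (poly 1 2 3 (T ⋆ T)) n ⟩
  (T ⋆ T) n + (T ⋆ poly 1 2 3 (T ⋆ T)) n      ≡⟨ cong ((T ⋆ T) n +_) (⋆-poly 1 2 3 T (T ⋆ T) n) ⟩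
  (T ⋆ T ⊕ poly 1 2 3 (T ⋆ (T ⋆ T))) n        ∎

S≗T⋆[T⋆T] : S ≗ T ⋆ (T ⋆ T)
S≗T⋆[T⋆T] n = sumTo-cong n λ k _ →
  trans (sumTo-cong (n ∸ k) (λ j _ → *-assoc (T k) (T j) _))
        (sym (*-distribˡ-sumTo (n ∸ k) (T k) _))

eliminate-T : ∀ k t u₀ u₁ u₂ w₀ w₁ w₂ →
  (2 + k) * t ≡ t + (1 * u₀ + 2 * u₁ + 3 * u₂) →
  (2 + k) * u₀ ≡ 2 * w₀ → (1 + k) * u₁ ≡ 2 * w₁ → k * u₂ ≡ 2 * w₂ →
  (2 + k) * (1 + k) * t ≡ 2 * w₀ + 2 * u₁ + 4 * w₁ + 6 * u₂ + 6 * w₂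
eliminate-T k t u₀ u₁ u₂ w₀ w₁ w₂ θt θu₀ θu₁ θu₂ = +-cancelˡ-≡ ((2 + k) * t) _ _ (begin
  (2 + k) * t + (2 + k) * (1 + k) * t
    ≡⟨ solve (k ∷ t ∷ []) ⟩
  (2 + k) * ((2 + k) * t)
    ≡⟨ cong ((2 + k) *_) θt ⟩
  (2 + k) * (t + (1 * u₀ + 2 * u₁ + 3 * u₂))
    ≡⟨ solve (k ∷ t ∷ u₀ ∷ u₁ ∷ u₂ ∷ []) ⟩
  (2 + k) * t + (2 + k) * u₀ + 2 * (u₁ + (1 + k) * u₁) + 3 * (2 * u₂ + k * u₂)
    ≡⟨ cong₂ _+_ (cong₂ _+_ (cong ((2 + k) * t +_) θu₀) (cong (λ z → 2 * (u₁ + z)) θu₁))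
                 (cong (λ z → 3 * (2 * u₂ + z)) θu₂) ⟩
  (2 + k) * t + 2 * w₀ + 2 * (u₁ + 2 * w₁) + 3 * (2 * u₂ + 2 * w₂)
    ≡⟨ solve (k ∷ t ∷ u₁ ∷ u₂ ∷ w₀ ∷ w₁ ∷ w₂ ∷ []) ⟩
  (2 + k) * t + (2 * w₀ + 2 * u₁ + 4 * w₁ + 6 * u₂ + 6 * w₂) ∎)

eliminate-U : ∀ u₂ u₃ u₄ v₀ v₁ v₂ v₃ v₄ v₅ w₂ w₃ w₄ →
  w₄ ≡ u₄ + (1 * v₄ + 2 * v₃ + 3 * v₂) →
  w₃ ≡ u₃ + (1 * v₃ + 2 * v₂ + 3 * v₁) →
  w₂ ≡ u₂ + (1 * v₂ + 2 * v₁ + 3 * v₀) →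
  v₅ ≡ u₄ + (1 * v₄ + 1 * v₃ + 1 * v₂) →
  v₄ ≡ u₃ + (1 * v₃ + 1 * v₂ + 1 * v₁) →
  v₃ ≡ u₂ + (1 * v₂ + 1 * v₁ + 1 * v₀) →
  2 * w₄ + 2 * u₃ + 4 * w₃ + 6 * u₂ + 6 * w₂ ≡ 6 * v₀ + 6 * v₁ + 12 * v₃ + 6 * v₄ + 2 * v₅
eliminate-U u₂ u₃ u₄ v₀ v₁ v₂ _ _ _ _ _ _ refl refl refl refl refl refl =
  solve (u₂ ∷ u₃ ∷ u₄ ∷ v₀ ∷ v₁ ∷ v₂ ∷ [])

theorem1 : (n : ℕ) → 5 ≤ n →
    (n ∸ 1) * (n ∸ 2) * T (n ∸ 1)
    ≡ 6 * S (n ∸ 5) + 6 * S (n ∸ 4) + 12 * S (n ∸ 2) + 6 * S (n ∸ 1) + 2 * S n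
theorem1 (suc (suc (suc (suc (suc m))))) (s≤s (s≤s (s≤s (s≤s (s≤s _))))) = begin
  (4 + m) * (3 + m) * T (4 + m)
    ≡⟨ eliminate-T (2 + m) (T (4 + m)) (U (4 + m)) (U (3 + m)) (U (2 + m))
         (W (4 + m)) (W (3 + m)) (W (2 + m))
         (θT-euler (4 + m)) (θ[T⋆T] (4 + m)) (θ[T⋆T] (3 + m)) (θ[T⋆T] (2 + m)) ⟩
  2 * W (4 + m) + 2 * U (3 + m) + 4 * W (3 + m) + 6 * U (2 + m) + 6 * W (2 + m)
    ≡⟨ eliminate-U (U (2 + m)) (U (3 + m)) (U (4 + m)) (V m) (V (1 + m)) (V (2 + m))
         (V (3 + m)) (V (4 + m)) (V (5 + m)) (W (2 + m)) (W (3 + m)) (W (4 + m))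
         (T⋆θT (4 + m)) (T⋆θT (3 + m)) (T⋆θT (2 + m))
         (T⋆-recurrence U (5 + m)) (T⋆-recurrence U (4 + m)) (T⋆-recurrence U (3 + m)) ⟩
  6 * V m + 6 * V (1 + m) + 12 * V (3 + m) + 6 * V (4 + m) + 2 * V (5 + m)
    ≡⟨ sym (cong₂ _+_ (cong₂ _+_ (cong₂ _+_ (cong₂ _+_
         (cong (6 *_) (S≗T⋆[T⋆T] m)) (cong (6 *_) (S≗T⋆[T⋆T] (1 + m))))
         (cong (12 *_) (S≗T⋆[T⋆T] (3 + m)))) (cong (6 *_) (S≗T⋆[T⋆T] (4 + m))))
         (cong (2 *_) (S≗T⋆[T⋆T] (5 + m)))) ⟩
  6 * S m + 6 * S (1 + m) + 12 * S (3 + m) + 6 * S (4 + m) + 2 * S (5 + m) ∎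
  where
  U = T ⋆ T
  V = T ⋆ U
  W = T ⋆ θ T
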